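{- Let $1\le t\le n$ and let $\mathcal{C}\subseteq\mathbb{S}_n$ be a $t$-balanced code. Define $X_{0,t}=\{t+1,\dots,n\}$, $X_{n-t,t}=\{1,\dots,n-t\}$, and $X_{s,t}=\{1,\dots,s,\,t+s+1,\dots,n\}$ for $1\le s\le n-t-1$. Then for every ordered sequence $\mathcal{I}=(i_1,\dots,i_{n-t})$ of pairwise distinct elements of $[n]$ and every $0\le s\le n-t$, there exists a unique codeword $\sigma\in\mathcal{C}$ such that for all $j\in X_{s,t}$, $$\sigma(j)=\begin{cases} i_j & \text{if } j\le s,\\ i_{j-t} & \text{if } j>s.\end{cases}$$
   Context: $\mathbb{S}_n$ is the group of permutations of $[n]=\{1,\dots,n\}$, written in one-line notation. The Kendall-$\tau$ distance $\mathrm{d}_\mathrm{K}(\sigma,\tau)$ is the minimum number of adjacent transpositions (swaps of two consecutive entries in one-line notation) needed to obtain $\sigma$ from $\tau$. A code is a subset $\mathcal{C}\subseteq\mathbb{S}_n$ with $|\mathcal{C}|\ge2$, with minimum distance $\mathrm{d}_\mathrm{K}(\mathcal{C})=\min\{\mathrm{d}_\mathrm{K}(\sigma,\tau):\sigma\ne\tau\in\mathcal{C}\}$. A code $\mathcal{C}\subseteq\mathbb{S}_n$ is $t$-balanced if $\mathrm{d}_\mathrm{K}(\mathcal{C})>\binom{t}{2}$ and $|\mathcal{C}|=n!/t!$. -}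

module Defs where

open import Data.Nat using (ℕ; zero; suc; _+_; _∸_; _≤_; _<_; _!; _<ᵇ_)
open import Data.Bool using (if_then_else_)
open import Data.Nat.Properties using (_!≢0)
open import Data.Nat.DivMod using (_/_)
open import Data.Nat.Combinatorics using (_C_)
open import Data.Fin using (Fin; toℕ; inject≤; raise; cast)
open import Data.Fin as F using ()
open import Data.Vec using (Vec; lookup; _[_]≔_)
open import Data.List using (List; length)
open import Data.List.Membership.Propositional using (_∈_)
open import Data.List.Relation.Unary.Unique.Propositional using (Unique)
open import Data.Product using (Σ; ∃; _×_; _,_)
open import Relation.Binary.PropositionalEquality using (_≡_; _≢_)
open import Relation.Nullary using (¬_)
open import Data.Nat.Properties using (m∸n+n≡m; +-comm)

-- A permutation of [n] in one-line notation: a vector (σ(1),…,σ(n)) of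
-- elements of [n] (0-indexed as Fin n) with pairwise distinct entries.
IsPerm : ∀ {n} → Vec (Fin n) n → Set
IsPerm {n} v = ∀ (i j : Fin n) → lookup v i ≡ lookup v j → i ≡ j

AdjSwap : ∀ {n} → Vec (Fin n) n → Vec (Fin n) n → Set
AdjSwap {n} u v =
  Σ (Fin n) λ i → Σ (Fin n) λ i' →
    (toℕ i' ≡ suc (toℕ i)) × (v ≡ ((u [ i ]≔ lookup u i') [ i' ]≔ lookup u i))

data Reach {n : ℕ} : ℕ → Vec (Fin n) n → Vec (Fin n) n → Set where
  done : ∀ {u} → Reach zero u u
  step : ∀ {k u v w} → AdjSwap u v → Reach k v w → Reach (suc k) u w

-- d_K(σ,τ) > m  (d_K = minimum number of adjacent transpositions):
-- no sequence of at most m adjacent transpositions turns τ into σ.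
dKgt : ∀ {n} → ℕ → Vec (Fin n) n → Vec (Fin n) n → Set
dKgt m σ τ = ∀ k → k ≤ m → ¬ Reach k τ σ

record Code (n : ℕ) : Set where
  field
    words   : List (Vec (Fin n) n)
    unique  : Unique words
    perms   : ∀ σ → σ ∈ words → IsPerm σ
    atLeast2 : 2 ≤ length words
open Code public

minDist> : ∀ {n} → Code n → ℕ → Set
minDist> Cd m = ∀ σ τ → σ ∈ words Cd → τ ∈ words Cd → σ ≢ τ → dKgt m σ τ

Balanced : ∀ {n} → ℕ → Code n → Set
Balanced {n} t Cd =
  minDist> Cd (t C 2) × (length (words Cd) ≡ (n ! / t !) {{t !≢0}})

-- 0-indexed version of the map  [n-t] → X_{s,t}:  the k-th entry i_k of the
-- sequence I is prescribed at position k if k ≤ s and at k + t if k > s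
-- (1-indexed).
-- Its image is exactly X_{s,t} (0-indexed), and for j ∈ X_{s,t} it is
-- inverted by j ↦ j (j ≤ s), j ↦ j - t (j > s), matching i_j / i_{j-t}.
pos : (s t k : ℕ) → ℕ
pos s t k = if k <ᵇ s then k else k + t

Agrees : ∀ {n t} → (s : ℕ) → (I : Fin (n ∸ t) → Fin n) → Vec (Fin n) n → Set
Agrees {n} {t} s I σ =
  ∀ (k : Fin (n ∸ t)) (j : Fin n) → toℕ j ≡ pos s t (toℕ k) → lookup σ j ≡ I k

{-# OPTIONS --safe #-}
-- Reading a permutation off at the n − t positions of X_{s,t} gives an injective sequence
-- of length n − t. Two permutations with the same reading differ only by a rearrangement
-- of the t consecutive positions s+1, …, s+t, which bubble sort undoes with at most C(t,2)
-- adjacent transpositions; so on a t-balanced code the reading is injective. There are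
-- exactly n!/t! = |C| injective sequences of length n − t, so it is also onto.
module Submission where

open import Defs
open import Data.Bool using (true; false)
open import Data.Fin as Fin using (Fin; toℕ; fromℕ<; punchIn; punchOut)
open import Data.Fin.Properties
  using (toℕ-injective; toℕ-fromℕ<; toℕ<n; suc-injective; <⇒≢; injective⇒≤;
         punchIn-punchOut; punchOut-injective)
  renaming (_≟_ to _≟ᶠ_; any? to anyᶠ?)
open import Data.List using (List; []; _∷_; [_]; _++_; length; map; allFin; cartesianProductWith)
open import Data.List.Properties using (length-++; length-map; length-tabulate)
open import Data.List.Membership.Propositional using (_∈_)
open import Data.List.Membership.Propositional.Properties
  using (∈-map⁻; ∈-allFin; ∈-cartesianProductWith⁺; ∈-∃++; ∈-++⁻; ∈-++⁺ˡ; ∈-++⁺ʳ)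
open import Data.List.Relation.Binary.Subset.Propositional using (_⊆_)
open import Data.List.Relation.Unary.Any using (here; there; any?)
import Data.List.Relation.Unary.All as All
import Data.List.Relation.Unary.All.Properties as All
open import Data.List.Relation.Unary.AllPairs using ([]; _∷_)
open import Data.List.Relation.Unary.Unique.Propositional using (Unique)
open import Data.Nat
  using (ℕ; zero; suc; _+_; _*_; _∸_; _≤_; _<_; _!; _<ᵇ_; z≤n; s≤s; z<s; s≤s⁻¹; _≤?_; _<?_; NonZero)
open import Data.Nat.Properties
  using (_!≢0; <ᵇ-reflects-<; +-suc; +-identityʳ; *-assoc; +-cancelʳ-≡; +-mono-≤; +-monoˡ-≤; +-monoˡ-<;
         ≤-refl; ≤-reflexive; ≤-trans; <-trans; <-≤-trans; ≤-<-trans; <-irrefl; <-cmp; <⇒≤; <⇒≱; ≤⇒≯;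
         ≰⇒>; ≮⇒≥; 1+n≰n; m≤n⇒m<n∨m≡n; m≤m+n; m≤n+m; m<m+n; m∸n≤m; m∸[m∸n]≡n; m+[n∸m]≡n;
         m+n∸m≡n; m+n∸n≡m; m∸n+n≡m; ∸-monoˡ-≤; ∸-monoˡ-<; module ≤-Reasoning)
open import Data.Nat.Combinatorics using (_C_; nC1≡n; nCk+nC[k+1]≡[n+1]C[k+1])
open import Data.Nat.DivMod using (_/_; m*n/n≡m)
open import Data.Product using (Σ; ∃; _×_; _,_; proj₁; proj₂)
open import Data.Sum using (_⊎_; inj₁; inj₂)
open import Data.Vec using (Vec; []; _∷_; lookup; tabulate; _[_]≔_)
import Data.Vec as Vec
open import Data.Vec.Properties
  using (lookup∘tabulate; tabulate-cong; lookup-map; lookup∘update; lookup∘update′; ≡-dec)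
open import Data.Vec.Relation.Binary.Pointwise.Extensional using (ext; Pointwise-≡⇒≡)
open import Function using (_∘_)
open import Function.Definitions using (Injective)
open import Relation.Binary.Definitions using (DecidableEquality; tri<; tri≈; tri>)
open import Relation.Binary.PropositionalEquality
  using (_≡_; _≢_; refl; sym; trans; cong; cong₂; subst; ≢-sym; module ≡-Reasoning)
open import Relation.Nullary using (yes; no; contradiction)
open import Relation.Nullary.Decidable using (decidable-stable)
open import Relation.Nullary.Reflects using (ofʸ; ofⁿ)

module _ {A : Set} where

  ∈-++-skip : ∀ {x y : A} xs ys → y ∈ xs ++ x ∷ ys → y ≢ x → y ∈ xs ++ ys
  ∈-++-skip xs ys y∈ y≢x with ∈-++⁻ xs y∈
  ... | inj₁ y∈xs         = ∈-++⁺ˡ y∈xs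
  ... | inj₂ (here y≡x)   = contradiction y≡x y≢x
  ... | inj₂ (there y∈ys) = ∈-++⁺ʳ xs y∈ys

  unique⊆⇒length≤ : ∀ {xs ys : List A} → Unique xs → xs ⊆ ys → length xs ≤ length ys
  unique⊆⇒length≤ {[]}     _            _     = z≤n
  unique⊆⇒length≤ {x ∷ xs} (x∉xs ∷ xs!) xs⊆ys with ∈-∃++ (xs⊆ys (here refl))
  ... | zs , ws , refl = begin
    suc (length xs)              ≤⟨ s≤s (unique⊆⇒length≤ xs! xs⊆zs++ws) ⟩
    suc (length (zs ++ ws))      ≡⟨ cong suc (length-++ zs) ⟩
    suc (length zs + length ws)  ≡⟨ +-suc (length zs) (length ws) ⟨
    length zs + length (x ∷ ws)  ≡⟨ length-++ zs ⟨
    length (zs ++ x ∷ ws)        ∎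
    where
    open ≤-Reasoning
    xs⊆zs++ws : xs ⊆ zs ++ ws
    xs⊆zs++ws y∈xs = ∈-++-skip zs ws (xs⊆ys (there y∈xs)) (≢-sym (All.lookup x∉xs y∈xs))

  unique⊆∧length≥⇒⊇ : DecidableEquality A → ∀ {xs ys : List A} →
                       Unique xs → xs ⊆ ys → length ys ≤ length xs → ys ⊆ xs
  unique⊆∧length≥⇒⊇ _≟_ {xs} {ys} xs! xs⊆ys |ys|≤|xs| {y} y∈ys with any? (y ≟_) xs
  ... | yes y∈xs = y∈xs
  ... | no  y∉xs = contradiction |ys|≤|xs|
                     (<⇒≱ (unique⊆⇒length≤ (All.¬Any⇒All¬ xs y∉xs ∷ xs!) y∷xs⊆ys))
    where
    y∷xs⊆ys : y ∷ xs ⊆ ys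
    y∷xs⊆ys (here refl) = y∈ys
    y∷xs⊆ys (there x∈)  = xs⊆ys x∈

InjectiveOn : {A B : Set} → (A → B) → List A → Set
InjectiveOn f xs = ∀ {x y} → x ∈ xs → y ∈ xs → f x ≡ f y → x ≡ y

module _ {A B : Set} {f : A → B} where

  Unique-map⁺ : ∀ {xs} → InjectiveOn f xs → Unique xs → Unique (map f xs)
  Unique-map⁺ _     []           = []
  Unique-map⁺ f-inj (x∉xs ∷ xs!) =
    All.map⁺ (All.tabulate λ y∈ fx≡fy → All.lookup x∉xs y∈ (f-inj (here refl) (there y∈) fx≡fy))
    ∷ Unique-map⁺ (λ x∈ y∈ → f-inj (there x∈) (there y∈)) xs!

  injectiveOn∧length≥⇒onto : DecidableEquality B → ∀ {xs ys} →
                             Unique xs → InjectiveOn f xs → (∀ {x} → x ∈ xs → f x ∈ ys) →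
                             length ys ≤ length xs → ∀ {y} → y ∈ ys → ∃ λ x → x ∈ xs × y ≡ f x
  injectiveOn∧length≥⇒onto _≟_ {xs} {ys} xs! f-inj f∈ys |ys|≤|xs| y∈ys =
    ∈-map⁻ f (unique⊆∧length≥⇒⊇ _≟_ (Unique-map⁺ f-inj xs!) fxs⊆ys |ys|≤|fxs| y∈ys)
    where
    fxs⊆ys : map f xs ⊆ ys
    fxs⊆ys fx∈ with ∈-map⁻ f fx∈
    ... | _ , x∈ , refl = f∈ys x∈
    |ys|≤|fxs| : length ys ≤ length (map f xs)
    |ys|≤|fxs| = subst (length ys ≤_) (sym (length-map f xs)) |ys|≤|xs|

length-cartesianProductWith : ∀ {A B C : Set} (f : A → B → C) xs ys →
                              length (cartesianProductWith f xs ys) ≡ length xs * length ys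
length-cartesianProductWith f []       ys = refl
length-cartesianProductWith f (x ∷ xs) ys = begin
  length (map (f x) ys ++ cartesianProductWith f xs ys)
    ≡⟨ length-++ (map (f x) ys) ⟩
  length (map (f x) ys) + length (cartesianProductWith f xs ys)
    ≡⟨ cong₂ _+_ (length-map (f x) ys) (length-cartesianProductWith f xs ys) ⟩
  length ys + length xs * length ys
    ∎
  where open ≡-Reasoning

_◃_ : ∀ {m k} → Fin (suc m) → Vec (Fin m) k → Vec (Fin (suc m)) (suc k)
c ◃ v = c ∷ Vec.map (punchIn c) v

arrangements : (k m : ℕ) → List (Vec (Fin m) k)
arrangements zero    m       = [ [] ]
arrangements (suc k) zero    = []
arrangements (suc k) (suc m) = cartesianProductWith _◃_ (allFin (suc m)) (arrangements k m)

length-arrangements : ∀ {k m} → k ≤ m → length (arrangements k m) * (m ∸ k) ! ≡ m !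
length-arrangements {zero}  {m}     _         = +-identityʳ (m !)
length-arrangements {suc k} {suc m} (s≤s k≤m) = begin
  length (cartesianProductWith _◃_ (allFin (suc m)) A) * (m ∸ k) !
    ≡⟨ cong (_* (m ∸ k) !) (length-cartesianProductWith _◃_ (allFin (suc m)) A) ⟩
  length (allFin (suc m)) * length A * (m ∸ k) !
    ≡⟨ cong (λ l → l * length A * (m ∸ k) !) (length-tabulate {n = suc m} (λ i → i)) ⟩
  suc m * length A * (m ∸ k) !
    ≡⟨ *-assoc (suc m) (length A) ((m ∸ k) !) ⟩
  suc m * (length A * (m ∸ k) !)
    ≡⟨ cong (suc m *_) (length-arrangements k≤m) ⟩
  suc m * m !
    ∎
  where
  open ≡-Reasoning
  A : List (Vec (Fin m) k)
  A = arrangements k m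

length-arrangements-∸ : ∀ {k m} → k ≤ m → length (arrangements (m ∸ k) m) ≡ (m ! / k !) {{k !≢0}}
length-arrangements-∸ {k} {m} k≤m = begin
  length A                          ≡⟨ m*n/n≡m (length A) (k !) ⟨
  length A * k ! / k !              ≡⟨ cong (λ j → length A * j ! / k !) (m∸[m∸n]≡n k≤m) ⟨
  length A * (m ∸ (m ∸ k)) ! / k !  ≡⟨ cong (_/ k !) (length-arrangements (m∸n≤m m k)) ⟩
  m ! / k !                         ∎
  where
  open ≡-Reasoning
  A : List (Vec (Fin m) (m ∸ k))
  A = arrangements (m ∸ k) m
  instance
    k!≢0 : NonZero (k !)
    k!≢0 = k !≢0

∈-arrangements : ∀ {k m} (v : Vec (Fin m) k) → Injective _≡_ _≡_ (lookup v) → v ∈ arrangements k m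
∈-arrangements {zero}          []       _       = here refl
∈-arrangements {suc k} {zero}  (() ∷ _) _
∈-arrangements {suc k} {suc m} (c ∷ w)  c∷w-inj =
  subst (_∈ arrangements (suc k) (suc m)) (cong (c ∷_) punchIn-w′≡w)
        (∈-cartesianProductWith⁺ _◃_ (∈-allFin c) (∈-arrangements w′ w′-inj))
  where
  c≢w : ∀ i → c ≢ lookup w i
  c≢w i c≡wi with c∷w-inj {Fin.zero} {Fin.suc i} c≡wi
  ... | ()
  w′ : Vec (Fin m) k
  w′ = tabulate (λ i → punchOut (c≢w i))
  lookup-w′ : ∀ i → lookup w′ i ≡ punchOut (c≢w i)
  lookup-w′ = lookup∘tabulate (λ i → punchOut (c≢w i))
  punchIn-w′≡w : Vec.map (punchIn c) w′ ≡ w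
  punchIn-w′≡w = Pointwise-≡⇒≡ (ext λ i → begin
    lookup (Vec.map (punchIn c) w′) i  ≡⟨ lookup-map i (punchIn c) w′ ⟩
    punchIn c (lookup w′ i)            ≡⟨ cong (punchIn c) (lookup-w′ i) ⟩
    punchIn c (punchOut (c≢w i))       ≡⟨ punchIn-punchOut (c≢w i) ⟩
    lookup w i                         ∎)
    where open ≡-Reasoning
  w′-inj : Injective _≡_ _≡_ (lookup w′)
  w′-inj {i} {j} w′i≡w′j = suc-injective (c∷w-inj (punchOut-injective (c≢w i) (c≢w j)
    (trans (sym (lookup-w′ i)) (trans w′i≡w′j (lookup-w′ j)))))

injective⇒surjective : ∀ {n} {f : Fin n → Fin n} → Injective _≡_ _≡_ f → ∀ y → ∃ λ x → f x ≡ y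
injective⇒surjective {zero}      _     ()
injective⇒surjective {suc m} {f} f-inj y with anyᶠ? (λ x → f x ≟ᶠ y)
... | yes hit  = hit
... | no  miss = contradiction (injective⇒≤ g-inj) 1+n≰n
  where
  y≢f : ∀ x → y ≢ f x
  y≢f x y≡fx = miss (x , sym y≡fx)
  g : Fin (suc m) → Fin m
  g x = punchOut (y≢f x)
  g-inj : Injective _≡_ _≡_ g
  g-inj {x} {x′} gx≡gx′ = f-inj (punchOut-injective (y≢f x) (y≢f x′) gx≡gx′)

[1+n]C2≡n+nC2 : ∀ n → suc n C 2 ≡ n + n C 2
[1+n]C2≡n+nC2 n = trans (sym (nCk+nC[k+1]≡[n+1]C[k+1] n 1)) (cong (_+ n C 2) (nC1≡n n))

module _ {A : Set} {m : ℕ} where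

  swap : Vec A m → Fin m → Fin m → Vec A m
  swap u i j = (u [ i ]≔ lookup u j) [ j ]≔ lookup u i

  lookup-swap-left : ∀ u {i j} → i ≢ j → lookup (swap u i j) i ≡ lookup u j
  lookup-swap-left u {i} {j} i≢j =
    trans (lookup∘update′ i≢j (u [ i ]≔ lookup u j) (lookup u i)) (lookup∘update i u (lookup u j))

  lookup-swap-right : ∀ u i j → lookup (swap u i j) j ≡ lookup u i
  lookup-swap-right u i j = lookup∘update j (u [ i ]≔ lookup u j) (lookup u i)

  lookup-swap-other : ∀ u {i j q} → q ≢ i → q ≢ j → lookup (swap u i j) q ≡ lookup u q
  lookup-swap-other u {i} {j} q≢i q≢j =
    trans (lookup∘update′ q≢j (u [ i ]≔ lookup u j) (lookup u i)) (lookup∘update′ q≢i u (lookup u j))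

_◅◅_ : ∀ {n k l} {u v w : Vec (Fin n) n} → Reach k u v → Reach l v w → Reach (k + l) u w
done       ◅◅ v↝w = v↝w
step s u↝v ◅◅ v↝w = step s (u↝v ◅◅ v↝w)

Inside Outside : ℕ → ℕ → ℕ → Set
Inside  a b j = a ≤ j × j < b
Outside a b j = j < a ⊎ b ≤ j

inside⊎outside : ∀ a b j → Inside a b j ⊎ Outside a b j
inside⊎outside a b j with a ≤? j | j <? b
... | yes a≤j | yes j<b = inj₁ (a≤j , j<b)
... | no  a≰j | _       = inj₂ (inj₁ (≰⇒> a≰j))
... | yes _   | no  j≮b = inj₂ (inj₂ (≮⇒≥ j≮b))

module _ {n : ℕ} where

  record Bubbling (d : ℕ) (i p : Fin n) (u : Vec (Fin n) n) : Set where
    field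
      result  : Vec (Fin n) n
      reach   : Reach d u result
      front   : lookup result i ≡ lookup u p
      shifted : ∀ q q′ → toℕ q′ ≡ suc (toℕ q) → Inside (toℕ i) (toℕ p) (toℕ q) →
                lookup result q′ ≡ lookup u q
      fixed   : ∀ q → Outside (toℕ i) (suc (toℕ p)) (toℕ q) → lookup result q ≡ lookup u q

  bubble : ∀ d (i p : Fin n) u → toℕ p ≡ toℕ i + d → Bubbling d i p u
  bubble zero i p u p≡i+0 = record
    { result  = u
    ; reach   = done
    ; front   = cong (lookup u) i≡p
    ; shifted = λ q _ _ (i≤q , q<p) →
                  contradiction (subst (toℕ q <_) (cong toℕ (sym i≡p)) q<p) (≤⇒≯ i≤q)
    ; fixed   = λ _ _ → refl
    }
    where
    i≡p : i ≡ p
    i≡p = toℕ-injective (sym (trans p≡i+0 (+-identityʳ (toℕ i))))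
  bubble (suc d) i p u p≡i+1+d = record
    { result  = B.result
    ; reach   = step (p⁻ , p , p≡1+p⁻ , refl) B.reach
    ; front   = trans B.front (lookup-swap-left u (<⇒≢ p⁻<p))
    ; shifted = shifted
    ; fixed   = fixed
    }
    where
    i+d<n : toℕ i + d < n
    i+d<n = <-trans (≤-reflexive (sym (trans p≡i+1+d (+-suc (toℕ i) d)))) (toℕ<n p)
    p⁻ : Fin n
    p⁻ = fromℕ< i+d<n
    p⁻≡i+d : toℕ p⁻ ≡ toℕ i + d
    p⁻≡i+d = toℕ-fromℕ< i+d<n
    p≡1+p⁻ : toℕ p ≡ suc (toℕ p⁻)
    p≡1+p⁻ = trans p≡i+1+d (trans (+-suc (toℕ i) d) (cong suc (sym p⁻≡i+d)))
    p⁻<p : toℕ p⁻ < toℕ p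
    p⁻<p = ≤-reflexive (sym p≡1+p⁻)
    module B = Bubbling (bubble d i p⁻ (swap u p⁻ p) p⁻≡i+d)
    shifted : ∀ q q′ → toℕ q′ ≡ suc (toℕ q) → Inside (toℕ i) (toℕ p) (toℕ q) →
              lookup B.result q′ ≡ lookup u q
    shifted q q′ q′≡1+q (i≤q , q<p) with m≤n⇒m<n∨m≡n (s≤s⁻¹ (subst (toℕ q <_) p≡1+p⁻ q<p))
    ... | inj₁ q<p⁻ =
      trans (B.shifted q q′ q′≡1+q (i≤q , q<p⁻)) (lookup-swap-other u (<⇒≢ q<p⁻) (<⇒≢ q<p))
    ... | inj₂ q≡p⁻ = begin
      lookup B.result q′      ≡⟨ cong (lookup B.result) q′≡p ⟩
      lookup B.result p       ≡⟨ B.fixed p (inj₂ (≤-reflexive (sym p≡1+p⁻))) ⟩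
      lookup (swap u p⁻ p) p  ≡⟨ lookup-swap-right u p⁻ p ⟩
      lookup u p⁻             ≡⟨ cong (lookup u) (toℕ-injective q≡p⁻) ⟨
      lookup u q              ∎
      where
      open ≡-Reasoning
      q′≡p : q′ ≡ p
      q′≡p = toℕ-injective (trans q′≡1+q (trans (cong suc q≡p⁻) (sym p≡1+p⁻)))
    fixed : ∀ q → Outside (toℕ i) (suc (toℕ p)) (toℕ q) → lookup B.result q ≡ lookup u q
    fixed q (inj₁ q<i) =
      trans (B.fixed q (inj₁ q<i)) (lookup-swap-other u (<⇒≢ q<p⁻) (<⇒≢ (<-trans q<p⁻ p⁻<p)))
      where
      q<p⁻ : toℕ q < toℕ p⁻
      q<p⁻ = <-≤-trans q<i (subst (toℕ i ≤_) (sym p⁻≡i+d) (m≤m+n (toℕ i) d))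
    fixed q (inj₂ p<q) = trans (B.fixed q (inj₂ (<-trans p⁻<p p<q)))
      (lookup-swap-other u (≢-sym (<⇒≢ (<-trans p⁻<p p<q))) (≢-sym (<⇒≢ p<q)))

  record Shuffled (a b : ℕ) (σ τ : Vec (Fin n) n) : Set where
    field
      outside : ∀ q → Outside a b (toℕ q) → lookup τ q ≡ lookup σ q
      inside  : ∀ q → Inside a b (toℕ q) → ∃ λ p → Inside a b (toℕ p) × lookup τ p ≡ lookup σ q

  shuffled-empty : ∀ {a b σ τ} → b ≤ a → Shuffled a b σ τ → τ ≡ σ
  shuffled-empty {a} {b} {σ} {τ} b≤a sh = Pointwise-≡⇒≡ (ext agree)
    where
    agree : ∀ q → lookup τ q ≡ lookup σ q
    agree q with inside⊎outside a b (toℕ q)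
    ... | inj₁ (a≤q , q<b) = contradiction (<-≤-trans q<b b≤a) (≤⇒≯ a≤q)
    ... | inj₂ q-out       = Shuffled.outside sh q q-out

  shuffled-bubble : ∀ {a b σ τ} (q₀ p : Fin n) → toℕ q₀ ≡ a → Inside a b (toℕ p) →
                    lookup τ p ≡ lookup σ q₀ → IsPerm σ → Shuffled a b σ τ →
                    ∃ λ u → Reach (toℕ p ∸ a) τ u × Shuffled (suc a) b σ u
  shuffled-bubble {a} {b} {σ} {τ} q₀ p q₀≡a (a≤p , p<b) τp≡σq₀ σ-perm sh =
    B.result , B.reach , record { outside = outside′ ; inside = inside′ }
    where
    open Shuffled sh
    module B = Bubbling (bubble (toℕ p ∸ a) q₀ p τ
                          (trans (sym (m+[n∸m]≡n a≤p)) (cong (_+ (toℕ p ∸ a)) (sym q₀≡a))))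
    q₀≤ : ∀ {j} → a ≤ j → toℕ q₀ ≤ j
    q₀≤ = subst (_≤ _) (sym q₀≡a)
    outside′ : ∀ q → Outside (suc a) b (toℕ q) → lookup B.result q ≡ lookup σ q
    outside′ q (inj₁ q<1+a) with m≤n⇒m<n∨m≡n (s≤s⁻¹ q<1+a)
    ... | inj₁ q<a = trans (B.fixed q (inj₁ (subst (toℕ q <_) (sym q₀≡a) q<a))) (outside q (inj₁ q<a))
    ... | inj₂ q≡a with toℕ-injective {i = q} {j = q₀} (trans q≡a (sym q₀≡a))
    ...   | refl = trans B.front τp≡σq₀
    outside′ q (inj₂ b≤q) = trans (B.fixed q (inj₂ (<-≤-trans p<b b≤q))) (outside q (inj₂ b≤q))
    inside′ : ∀ q → Inside (suc a) b (toℕ q) →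
              ∃ λ p′ → Inside (suc a) b (toℕ p′) × lookup B.result p′ ≡ lookup σ q
    inside′ q (a<q , q<b) with inside q (<⇒≤ a<q , q<b)
    ... | p′ , (a≤p′ , p′<b) , τp′≡σq with <-cmp (toℕ p′) (toℕ p)
    ... | tri< p′<p _ _ =
      p″ , subst (Inside (suc a) b) (sym p″≡1+p′) (s≤s a≤p′ , ≤-<-trans p′<p p<b) ,
      trans (B.shifted p′ p″ p″≡1+p′ (q₀≤ a≤p′ , p′<p)) τp′≡σq
      where
      1+p′<n : suc (toℕ p′) < n
      1+p′<n = <-≤-trans (s≤s p′<p) (toℕ<n p)
      p″ : Fin n
      p″ = fromℕ< 1+p′<n
      p″≡1+p′ : toℕ p″ ≡ suc (toℕ p′)
      p″≡1+p′ = toℕ-fromℕ< 1+p′<n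
    ... | tri≈ _ p′≡p _ = contradiction (subst (a <_) (trans (cong toℕ q≡q₀) q₀≡a) a<q) (<-irrefl refl)
      where
      q≡q₀ : q ≡ q₀
      q≡q₀ = σ-perm q q₀ (trans (sym τp′≡σq) (trans (cong (lookup τ) (toℕ-injective p′≡p)) τp≡σq₀))
    ... | tri> _ _ p<p′ = p′ , (≤-<-trans a≤p p<p′ , p′<b) , trans (B.fixed p′ (inj₂ p<p′)) τp′≡σq

  shuffled⇒reach : ∀ w {a b σ τ} → a + w ≡ b → b ≤ n → IsPerm σ → Shuffled a b σ τ →
                   ∃ λ k → k ≤ w C 2 × Reach k τ σ
  shuffled⇒reach zero {a} {b} {τ = τ} a+0≡b _ _ sh =
    0 , z≤n , subst (Reach 0 τ) (shuffled-empty b≤a sh) done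
    where
    b≤a : b ≤ a
    b≤a = ≤-reflexive (trans (sym a+0≡b) (+-identityʳ a))
  shuffled⇒reach (suc w) {a} {b} a+1+w≡b b≤n σ-perm sh =
    let p , p-in@(a≤p , p<b) , τp≡σq₀ = Shuffled.inside sh q₀ q₀-in
        u , τ↝u , sh′ = shuffled-bubble q₀ p q₀≡a p-in τp≡σq₀ σ-perm sh
        k , k≤wC2 , u↝σ = shuffled⇒reach w 1+a+w≡b b≤n σ-perm sh′
    in toℕ p ∸ a + k , cost≤ (s≤s⁻¹ (j∸a<1+w a≤p p<b)) k≤wC2 , τ↝u ◅◅ u↝σ
    where
    a<b : a < b
    a<b = subst (a <_) a+1+w≡b (m<m+n a z<s)
    q₀ : Fin n
    q₀ = fromℕ< (<-≤-trans a<b b≤n)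
    q₀≡a : toℕ q₀ ≡ a
    q₀≡a = toℕ-fromℕ< (<-≤-trans a<b b≤n)
    q₀-in : Inside a b (toℕ q₀)
    q₀-in = ≤-reflexive (sym q₀≡a) , subst (_< b) (sym q₀≡a) a<b
    1+a+w≡b : suc a + w ≡ b
    1+a+w≡b = trans (sym (+-suc a w)) a+1+w≡b
    j∸a<1+w : ∀ {j} → a ≤ j → j < b → j ∸ a < suc w
    j∸a<1+w {j} a≤j j<b =
      subst (j ∸ a <_) (trans (cong (_∸ a) (sym a+1+w≡b)) (m+n∸m≡n a (suc w))) (∸-monoˡ-< j<b a≤j)
    cost≤ : ∀ {d k} → d ≤ w → k ≤ w C 2 → d + k ≤ suc w C 2
    cost≤ {d} {k} d≤w k≤wC2 = subst (d + k ≤_) (sym ([1+n]C2≡n+nC2 w)) (+-mono-≤ d≤w k≤wC2)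

pos-< : ∀ {s t k} → k < s → pos s t k ≡ k
pos-< {s} {t} {k} k<s with k <ᵇ s | <ᵇ-reflects-< k s
... | true  | _       = refl
... | false | ofⁿ k≮s = contradiction k<s k≮s

pos-≥ : ∀ {s t k} → s ≤ k → pos s t k ≡ k + t
pos-≥ {s} {t} {k} s≤k with k <ᵇ s | <ᵇ-reflects-< k s
... | true  | ofʸ k<s = contradiction s≤k (<⇒≱ k<s)
... | false | _       = refl

pos≤+ : ∀ s t k → pos s t k ≤ k + t
pos≤+ s t k with k <ᵇ s
... | true  = m≤m+n k t
... | false = ≤-refl

pos-straddle : ∀ s t {k l} → k < s → s ≤ l → pos s t k < pos s t l
pos-straddle s t {k} {l} k<s s≤l = begin-strict
  pos s t k  ≡⟨ pos-< k<s ⟩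
  k          <⟨ <-≤-trans k<s s≤l ⟩
  l          ≤⟨ m≤m+n l t ⟩
  l + t      ≡⟨ pos-≥ s≤l ⟨
  pos s t l  ∎
  where open ≤-Reasoning

pos-injective : ∀ s t {k l} → pos s t k ≡ pos s t l → k ≡ l
pos-injective s t {k} {l} eq with k <? s | l <? s
... | yes k<s | yes l<s = trans (sym (pos-< k<s)) (trans eq (pos-< l<s))
... | no  k≮s | no  l≮s =
  +-cancelʳ-≡ t k l (trans (sym (pos-≥ (≮⇒≥ k≮s))) (trans eq (pos-≥ (≮⇒≥ l≮s))))
... | yes k<s | no  l≮s = contradiction (pos-straddle s t k<s (≮⇒≥ l≮s)) (<-irrefl eq)
... | no  k≮s | yes l<s = contradiction (pos-straddle s t l<s (≮⇒≥ k≮s)) (<-irrefl (sym eq))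

module Reading {n t s : ℕ} (t≤n : t ≤ n) (s≤n∸t : s ≤ n ∸ t) where

  pos<n : (k : Fin (n ∸ t)) → pos s t (toℕ k) < n
  pos<n k = ≤-<-trans (pos≤+ s t (toℕ k))
                      (subst (toℕ k + t <_) (m∸n+n≡m t≤n) (+-monoˡ-< t (toℕ<n k)))

  position : Fin (n ∸ t) → Fin n
  position k = fromℕ< (pos<n k)

  toℕ-position : ∀ k → toℕ (position k) ≡ pos s t (toℕ k)
  toℕ-position k = toℕ-fromℕ< (pos<n k)

  position-injective : Injective _≡_ _≡_ position
  position-injective {k} {l} eq = toℕ-injective (pos-injective s t
    (trans (sym (toℕ-position k)) (trans (cong toℕ eq) (toℕ-position l))))

  pos-preimage : ∀ {j} → j < n → Outside s (s + t) j → ∃ λ (k : Fin (n ∸ t)) → pos s t (toℕ k) ≡ j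
  pos-preimage {j} _ (inj₁ j<s) =
    fromℕ< j<n∸t , trans (cong (pos s t) (toℕ-fromℕ< j<n∸t)) (pos-< j<s)
    where
    j<n∸t : j < n ∸ t
    j<n∸t = <-≤-trans j<s s≤n∸t
  pos-preimage {j} j<n (inj₂ s+t≤j) = fromℕ< j∸t<n∸t , (begin
    pos s t (toℕ (fromℕ< j∸t<n∸t))  ≡⟨ cong (pos s t) (toℕ-fromℕ< j∸t<n∸t) ⟩
    pos s t (j ∸ t)                 ≡⟨ pos-≥ (subst (_≤ j ∸ t) (m+n∸n≡m s t) (∸-monoˡ-≤ t s+t≤j)) ⟩
    j ∸ t + t                       ≡⟨ m∸n+n≡m t≤j ⟩
    j                               ∎)
    where
    open ≡-Reasoning
    t≤j : t ≤ j
    t≤j = ≤-trans (m≤n+m t s) s+t≤j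
    j∸t<n∸t : j ∸ t < n ∸ t
    j∸t<n∸t = ∸-monoˡ-< j<n t≤j

  position-onto : ∀ q → Outside s (s + t) (toℕ q) → ∃ λ k → position k ≡ q
  position-onto q q-out =
    let k , pos≡q = pos-preimage (toℕ<n q) q-out in k , toℕ-injective (trans (toℕ-position k) pos≡q)

  read : Vec (Fin n) n → Vec (Fin n) (n ∸ t)
  read σ = tabulate (lookup σ ∘ position)

  lookup-read : ∀ σ k → lookup (read σ) k ≡ lookup σ (position k)
  lookup-read σ = lookup∘tabulate (lookup σ ∘ position)

  read-injective : ∀ {σ} → IsPerm σ → Injective _≡_ _≡_ (lookup (read σ))
  read-injective {σ} σ-perm {k} {l} eq =
    position-injective (σ-perm _ _ (trans (sym (lookup-read σ k)) (trans eq (lookup-read σ l))))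

  Agrees⇒read≡ : ∀ {I σ} → Agrees {n} {t} s I σ → read σ ≡ tabulate I
  Agrees⇒read≡ agrees = tabulate-cong (λ k → agrees k (position k) (toℕ-position k))

  read≡⇒Agrees : ∀ {I σ} → read σ ≡ tabulate I → Agrees {n} {t} s I σ
  read≡⇒Agrees {I} {σ} eq k j j≡pos
    with toℕ-injective {i = j} {j = position k} (trans j≡pos (sym (toℕ-position k)))
  ... | refl = begin
    lookup σ (position k)  ≡⟨ lookup-read σ k ⟨
    lookup (read σ) k      ≡⟨ cong (λ v → lookup v k) eq ⟩
    lookup (tabulate I) k  ≡⟨ lookup∘tabulate I k ⟩
    I k                    ∎
    where open ≡-Reasoning

  read≡⇒shuffled : ∀ {σ τ} → IsPerm σ → IsPerm τ → read σ ≡ read τ → Shuffled s (s + t) σ τ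
  read≡⇒shuffled {σ} {τ} σ-perm τ-perm eq = record { outside = agree ; inside = cover }
    where
    agree : ∀ q → Outside s (s + t) (toℕ q) → lookup τ q ≡ lookup σ q
    agree q q-out with position-onto q q-out
    ... | k , refl = begin
      lookup τ (position k)  ≡⟨ lookup-read τ k ⟨
      lookup (read τ) k      ≡⟨ cong (λ v → lookup v k) eq ⟨
      lookup (read σ) k      ≡⟨ lookup-read σ k ⟩
      lookup σ (position k)  ∎
      where open ≡-Reasoning
    cover : ∀ q → Inside s (s + t) (toℕ q) →
            ∃ λ p → Inside s (s + t) (toℕ p) × lookup τ p ≡ lookup σ q
    cover q q-in with injective⇒surjective (τ-perm _ _) (lookup σ q)
    ... | p , τp≡σq with inside⊎outside s (s + t) (toℕ p)
    ... | inj₁ p-in  = p , p-in , τp≡σq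
    ... | inj₂ p-out = p , subst (Inside s (s + t) ∘ toℕ) q≡p q-in , τp≡σq
      where
      q≡p : q ≡ p
      q≡p = σ-perm q p (trans (sym τp≡σq) (agree p p-out))

  read-injectiveOn : (Cd : Code n) → minDist> Cd (t C 2) → InjectiveOn read (words Cd)
  read-injectiveOn Cd far {σ} {τ} σ∈Cd τ∈Cd eq =
    let k , k≤tC2 , τ↝σ = shuffled⇒reach t refl s+t≤n σ-perm (read≡⇒shuffled σ-perm τ-perm eq)
    in decidable-stable (≡-dec _≟ᶠ_ σ τ) (λ σ≢τ → far σ τ σ∈Cd τ∈Cd σ≢τ k k≤tC2 τ↝σ)
    where
    σ-perm : IsPerm σ
    σ-perm = perms Cd σ σ∈Cd
    τ-perm : IsPerm τ
    τ-perm = perms Cd τ τ∈Cd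
    s+t≤n : s + t ≤ n
    s+t≤n = subst (s + t ≤_) (m∸n+n≡m t≤n) (+-monoˡ-≤ t s≤n∸t)

theorem4p2 : ∀ (n t : ℕ) → 1 ≤ t → t ≤ n → (Cd : Code n) → Balanced t Cd →
    (I : Fin (n ∸ t) → Fin n) → Injective _≡_ _≡_ I →
    (s : ℕ) → s ≤ n ∸ t →
    Σ (Vec (Fin n) n) λ σ → (σ ∈ words Cd) × Agrees {n} {t} s I σ ×
      (∀ τ → τ ∈ words Cd → Agrees {n} {t} s I τ → τ ≡ σ)
theorem4p2 n t _ t≤n Cd (far , |Cd|) I I-inj s s≤n∸t =
  σ , σ∈Cd , read≡⇒Agrees {σ = σ} (sym I≡readσ) ,
  λ τ τ∈Cd τ-agrees → read-injective-Cd τ∈Cd σ∈Cd (trans (Agrees⇒read≡ {σ = τ} τ-agrees) I≡readσ)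
  where
  open Reading t≤n s≤n∸t
  read-injective-Cd : InjectiveOn read (words Cd)
  read-injective-Cd = read-injectiveOn Cd far
  I∈arrangements : tabulate I ∈ arrangements (n ∸ t) n
  I∈arrangements = ∈-arrangements (tabulate I)
    λ {k} {l} eq → I-inj (trans (sym (lookup∘tabulate I k)) (trans eq (lookup∘tabulate I l)))
  preimage : ∃ λ σ → σ ∈ words Cd × tabulate I ≡ read σ
  preimage = injectiveOn∧length≥⇒onto (≡-dec _≟ᶠ_) (unique Cd) read-injective-Cd
    (λ {σ} σ∈Cd → ∈-arrangements (read σ) (read-injective {σ} (perms Cd σ σ∈Cd)))
    (≤-reflexive (trans (length-arrangements-∸ t≤n) (sym |Cd|)))
    I∈arrangements
  σ : Vec (Fin n) n
  σ = proj₁ preimage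
  σ∈Cd : σ ∈ words Cd
  σ∈Cd = proj₁ (proj₂ preimage)
  I≡readσ : tabulate I ≡ read σ
  I≡readσ = proj₂ (proj₂ preimage)
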